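{- For any $n$ and $k$, any deterministic algorithm solving the successive sorting problem must perform $\Omega(nk\log k)$ comparisons in the worst case.
   Context: Successive sorting problem: given $n$ arrays $a_1,\dots,a_n$, each a permutation of $\{1,\dots,k\}$, output $n$ arrays $S_1,\dots,S_n$ of length $k$ such that for each $i$, $a_i[S_i[1]]<a_i[S_i[2]]<\dots<a_i[S_i[k]]$. The model is the comparison-addition Word-RAM: the values $a_i[j]$ are stored in protected cells and cannot be accessed directly; the only operations on them are \textsc{Add} (producing a protected cell holding the sum) and \textsc{Compare} (returning $-1,0,1$); comparisons are \textsc{Compare} operations. -}

module Defs where

open import Data.Nat using (ℕ; zero; suc; _+_; _*_; _≤_; _<_)
open import Data.Fin using (Fin) renaming (_<_ to _<ᶠ_)
open import Data.Fin as F using ()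
open import Data.Product using (_×_)
open import Function.Definitions using (Injective)
open import Relation.Binary.PropositionalEquality using (_≡_)

∑ : (m : ℕ) → (Fin m → ℕ) → ℕ
∑ zero    f = 0
∑ (suc m) f = f F.zero + ∑ m (λ j → f (F.suc j))

Input : ℕ → ℕ → Set
Input n k = Fin n → Fin k → ℕ

IsPermOf1k : (k : ℕ) → (Fin k → ℕ) → Set
IsPermOf1k k r = (∀ j → 1 ≤ r j × r j ≤ k) × Injective _≡_ _≡_ r

Valid : (n k : ℕ) → Input n k → Set
Valid n k a = ∀ i → IsPermOf1k k (a i)

-- Output: S i j = S_i[j] (an index into a_i).
Output : ℕ → ℕ → Set
Output n k = Fin n → Fin k → Fin k

SortedOutput : (n k : ℕ) → Input n k → Output n k → Set
SortedOutput n k a S = ∀ i (j j' : Fin k) → j <ᶠ j' → a i (S i j) < a i (S i j')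

-- Contents of a protected cell: a sum of input values with multiplicities,
-- i.e. a linear form with natural coefficients c i j.
LinForm : ℕ → ℕ → Set
LinForm n k = Fin n → Fin k → ℕ

eval : {n k : ℕ} → LinForm n k → Input n k → ℕ
eval {n} {k} c a = ∑ n (λ i → ∑ k (λ j → c i j * a i j))

-- A deterministic algorithm in the comparison-addition model, viewed as its
-- decision tree: each internal node is one Compare of two protected cells
-- (with outcome -1, 0, 1 selecting the continuation); leaves output S.
data Cmp : Set where
  less equal greater : Cmp

data Tree (n k : ℕ) : Set where
  leaf : Output n k → Tree n k
  node : LinForm n k → LinForm n k → (Cmp → Tree n k) → Tree n k

compareℕ : ℕ → ℕ → Cmp
compareℕ zero    zero    = equal
compareℕ zero    (suc _) = less
compareℕ (suc _) zero    = greater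
compareℕ (suc x) (suc y) = compareℕ x y

run : {n k : ℕ} → Tree n k → Input n k → Output n k
run (leaf S) a = S
run (node x y t) a = run (t (compareℕ (eval x a) (eval y a))) a

comparisons : {n k : ℕ} → Tree n k → Input n k → ℕ
comparisons (leaf S) a = 0
comparisons (node x y t) a =
  suc (comparisons (t (compareℕ (eval x a) (eval y a))) a)

Solves : (n k : ℕ) → Tree n k → Set
Solves n k T = ∀ (a : Input n k) → Valid n k a → SortedOutput n k a (run T a)

-- The outcomes of the comparisons made on an input form a ternary word whose
-- length is the number of comparisons, and this word determines the output.
-- A correct algorithm must produce distinct outputs on distinct inputs, since
-- the sorting permutations determine the arrays. Running it on all (k!)ⁿ
-- inputs coded by Lehmer codes, some input therefore costs D comparisons
-- with (k!)ⁿ ≤ 3ᴰ; together with kᵏ ≤ (k!)² and 2^⌊log₂ k⌋ ≤ k this gives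
-- n k ⌊log₂ k⌋ ≤ 4 D.
module Submission where

open import Defs
open import Data.Nat
open import Data.Nat.Properties
open import Data.Nat.Induction using (Acc; acc)
open import Data.Nat.Logarithm using (⌊log₂_⌋)
open import Data.Nat.Logarithm.Core using (⌊log2⌋)
open import Data.Nat.Tactic.RingSolver using (solve-∀)
open import Data.Fin
  using (Fin; zero; suc; toℕ; fromℕ<; punchIn; combine; quotient; remainder; finToFun; funToFin)
  renaming (_<_ to _<ᶠ_)
open import Data.Fin.Properties
  using (toℕ-injective; toℕ<n; toℕ-fromℕ<; punchIn-injective; punchInᵢ≢i;
         combine-injective; combine-remQuot; funToFin-finToFin; injective⇒≤)
open import Data.List using (allFin)
open import Data.List.Extrema ≤-totalOrder using (argmax; v≤f[argmax]⁺)
open import Data.List.Membership.Propositional.Properties using (∈-allFin)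
import Data.List.Relation.Unary.Any as Any
open import Data.Empty using (⊥-elim)
open import Data.Product using (_×_; _,_; proj₁; proj₂; ∃-syntax)
open import Data.Sum using (inj₂)
open import Function using (_∘_)
open import Function.Definitions using (Injective)
open import Relation.Binary.PropositionalEquality

^-cancelˡ-≤ : ∀ b {m n} → 1 < b → b ^ m ≤ b ^ n → m ≤ n
^-cancelˡ-≤ b 1<b bᵐ≤bⁿ = ≮⇒≥ (λ n<m → <⇒≱ (^-monoʳ-< b 1<b n<m) bᵐ≤bⁿ)

⌊n/2⌋+⌊n/2⌋≤n : ∀ n → ⌊ n /2⌋ + ⌊ n /2⌋ ≤ n
⌊n/2⌋+⌊n/2⌋≤n n = begin
  ⌊ n /2⌋ + ⌊ n /2⌋ ≤⟨ +-monoʳ-≤ ⌊ n /2⌋ (⌊n/2⌋≤⌈n/2⌉ n) ⟩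
  ⌊ n /2⌋ + ⌈ n /2⌉ ≡⟨ ⌊n/2⌋+⌈n/2⌉≡n n ⟩
  n                 ∎
  where open ≤-Reasoning

2^⌊log2⌋≤n : ∀ n (rec : Acc _<_ (suc n)) → 2 ^ ⌊log2⌋ (suc n) rec ≤ suc n
2^⌊log2⌋≤n zero    _         = ≤-refl
2^⌊log2⌋≤n (suc n) (acc _)   = begin
  2 * 2 ^ ⌊log2⌋ (suc ⌊ n /2⌋) _ ≤⟨ *-monoʳ-≤ 2 (2^⌊log2⌋≤n ⌊ n /2⌋ _) ⟩
  2 * suc ⌊ n /2⌋                 ≡⟨ *-suc 2 ⌊ n /2⌋ ⟩
  2 + 2 * ⌊ n /2⌋                 ≡⟨ cong (λ h → 2 + (⌊ n /2⌋ + h)) (+-identityʳ ⌊ n /2⌋) ⟩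
  2 + (⌊ n /2⌋ + ⌊ n /2⌋)         ≤⟨ +-monoʳ-≤ 2 (⌊n/2⌋+⌊n/2⌋≤n n) ⟩
  suc (suc n)                     ∎
  where open ≤-Reasoning

2^⌊log₂n⌋≤n : ∀ n .{{_ : NonZero n}} → 2 ^ ⌊log₂ n ⌋ ≤ n
2^⌊log₂n⌋≤n (suc n) = 2^⌊log2⌋≤n n _

[2^⌊log₂n⌋]^n≤n^n : ∀ n → (2 ^ ⌊log₂ n ⌋) ^ n ≤ n ^ n
[2^⌊log₂n⌋]^n≤n^n zero      = ≤-refl
[2^⌊log₂n⌋]^n≤n^n n@(suc _) = ^-monoˡ-≤ n (2^⌊log₂n⌋≤n n)

-- The inductive form of pairing the factors j and n + 1 − j of n!, whose
-- product is at least n.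
[i+r]^i*r!≤i!*[i+r]! : ∀ i r → (i + r) ^ i * r ! ≤ i ! * (i + r) !
[i+r]^i*r!≤i!*[i+r]! zero    r = ≤-refl
[i+r]^i*r!≤i!*[i+r]! (suc i) r = *-cancelˡ-≤ (suc r) (begin
  suc r * (m * m ^ i * r !)        ≡⟨ rearrange₁ (suc r) m (m ^ i) (r !) ⟩
  m * (m ^ i * (suc r * r !))      ≤⟨ *-monoʳ-≤ m ih ⟩
  m * (i ! * m !)                  ≤⟨ *-monoˡ-≤ (i ! * m !) m≤[1+i]*[1+r] ⟩
  suc i * suc r * (i ! * m !)      ≡⟨ rearrange₂ (suc i) (suc r) (i !) (m !) ⟩
  suc r * (suc i * i ! * m !)      ∎)
  where
  open ≤-Reasoning
  m : ℕ
  m = suc i + r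
  ih : m ^ i * (suc r * r !) ≤ i ! * m !
  ih = subst (λ l → l ^ i * (suc r * r !) ≤ i ! * l !) (+-suc i r)
         ([i+r]^i*r!≤i!*[i+r]! i (suc r))
  m≤[1+i]*[1+r] : m ≤ suc i * suc r
  m≤[1+i]*[1+r] = subst (m ≤_) (sym (*-suc (suc i) r)) (+-monoʳ-≤ (suc i) (m≤n*m r (suc i)))
  rearrange₁ : ∀ a b c d → a * (b * c * d) ≡ b * (c * (a * d))
  rearrange₁ = solve-∀
  rearrange₂ : ∀ a b c d → a * b * (c * d) ≡ b * (a * c * d)
  rearrange₂ = solve-∀

n^n≤[n!]² : ∀ n → n ^ n ≤ (n !) ^ 2
n^n≤[n!]² n = begin
  n ^ n             ≡⟨ sym (*-identityʳ (n ^ n)) ⟩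
  n ^ n * 0 !       ≡⟨ cong (λ l → l ^ n * 1) (+-identityʳ n) ⟨
  (n + 0) ^ n * 0 ! ≤⟨ [i+r]^i*r!≤i!*[i+r]! n 0 ⟩
  n ! * (n + 0) !   ≡⟨ cong (λ l → n ! * l !) (+-identityʳ n) ⟩
  n ! * n !         ≡⟨ cong (n ! *_) (*-identityʳ (n !)) ⟨
  (n !) ^ 2         ∎
  where open ≤-Reasoning

[n!]^m≤3^d⇒m*n*⌊log₂n⌋≤4*d : ∀ m n d → (n !) ^ m ≤ 3 ^ d → m * n * ⌊log₂ n ⌋ ≤ 4 * d
[n!]^m≤3^d⇒m*n*⌊log₂n⌋≤4*d m n d [n!]^m≤3^d = ^-cancelˡ-≤ 2 (s≤s (s≤s z≤n)) (begin
  2 ^ (m * n * t)          ≡⟨ cong (2 ^_) (reverse-factors m n t) ⟩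
  2 ^ (t * n * m)          ≡⟨ ^-*-assoc 2 (t * n) m ⟨
  (2 ^ (t * n)) ^ m        ≡⟨ cong (_^ m) (^-*-assoc 2 t n) ⟨
  ((2 ^ t) ^ n) ^ m        ≤⟨ ^-monoˡ-≤ m ([2^⌊log₂n⌋]^n≤n^n n) ⟩
  (n ^ n) ^ m              ≤⟨ ^-monoˡ-≤ m (n^n≤[n!]² n) ⟩
  ((n !) ^ 2) ^ m          ≡⟨ ^-*-assoc (n !) 2 m ⟩
  (n !) ^ (2 * m)          ≡⟨ cong ((n !) ^_) (*-comm 2 m) ⟩
  (n !) ^ (m * 2)          ≡⟨ ^-*-assoc (n !) m 2 ⟨
  ((n !) ^ m) ^ 2          ≤⟨ ^-monoˡ-≤ 2 [n!]^m≤3^d ⟩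
  (3 ^ d) ^ 2              ≤⟨ ^-monoˡ-≤ 2 (^-monoˡ-≤ d (s≤s (s≤s (s≤s z≤n)))) ⟩
  ((2 ^ 2) ^ d) ^ 2        ≡⟨ cong (_^ 2) (^-*-assoc 2 2 d) ⟩
  (2 ^ (2 * d)) ^ 2        ≡⟨ ^-*-assoc 2 (2 * d) 2 ⟩
  2 ^ (2 * d * 2)          ≡⟨ cong (2 ^_) (*-comm (2 * d) 2) ⟩
  2 ^ (2 * (2 * d))        ≡⟨ cong (2 ^_) (*-assoc 2 2 d) ⟨
  2 ^ (4 * d)              ∎)
  where
  open ≤-Reasoning
  t : ℕ
  t = ⌊log₂ n ⌋
  reverse-factors : ∀ a b c → a * b * c ≡ c * b * a
  reverse-factors = solve-∀

maximum-attained : ∀ {N} → Fin N → (g : Fin N → ℕ) → ∃[ x ] ∀ y → g y ≤ g x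
maximum-attained x₀ g = argmax g x₀ (allFin _) , λ y →
  v≤f[argmax]⁺ x₀ (allFin _) (inj₂ (Any.map (≤-reflexive ∘ cong g) (∈-allFin y)))

funToFin-cong : ∀ {m n} {f g : Fin m → Fin n} → (∀ i → f i ≡ g i) → funToFin f ≡ funToFin g
funToFin-cong {zero}  _   = refl
funToFin-cong {suc m} f≗g = cong₂ combine (f≗g zero) (funToFin-cong (f≗g ∘ suc))

finToFun-faithful : ∀ {m n} {x y : Fin (m ^ n)} →
  (∀ i → finToFun {m} {n} x i ≡ finToFun y i) → x ≡ y
finToFun-faithful {m} {n} {x} {y} eq = begin
  x                             ≡⟨ funToFin-finToFin {n} {m} x ⟨
  funToFin (finToFun {m} {n} x) ≡⟨ funToFin-cong eq ⟩
  funToFin (finToFun {m} {n} y) ≡⟨ funToFin-finToFin {n} {m} y ⟩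
  y                             ∎
  where open ≡-Reasoning

insert : ∀ {k} → Fin (suc k) → (Fin k → Fin k) → Fin (suc k) → Fin (suc k)
insert c σ zero    = c
insert c σ (suc j) = punchIn c (σ j)

insert-injective : ∀ {k} c {σ : Fin k → Fin k} →
  Injective _≡_ _≡_ σ → Injective _≡_ _≡_ (insert c σ)
insert-injective c σ-inj {zero}  {zero}  _  = refl
insert-injective c σ-inj {zero}  {suc j} eq = ⊥-elim (punchInᵢ≢i c _ (sym eq))
insert-injective c σ-inj {suc i} {zero}  eq = ⊥-elim (punchInᵢ≢i c _ eq)
insert-injective c σ-inj {suc i} {suc j} eq = cong suc (σ-inj (punchIn-injective c _ _ eq))

-- The permutation with Lehmer code x, read in the mixed radix k, k − 1, …, 1:
-- the leading digit is the image of zero, and the remaining digits place the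
-- other points around it.
lehmer : ∀ k → Fin (k !) → Fin k → Fin k
lehmer zero    _ ()
lehmer (suc k) x = insert (quotient (k !) x) (lehmer k (remainder {suc k} (k !) x))

lehmer-injective : ∀ k x → Injective _≡_ _≡_ (lehmer k x)
lehmer-injective zero    _ {()}
lehmer-injective (suc k) x = insert-injective _ (lehmer-injective k _)

lehmer-faithful : ∀ k {x y} → (∀ j → lehmer k x j ≡ lehmer k y j) → x ≡ y
lehmer-faithful zero    {zero} {zero} _  = refl
lehmer-faithful (suc k) {x} {y} eq = begin
  x                                                      ≡⟨ combine-remQuot {suc k} (k !) x ⟨
  combine (quotient (k !) x) (remainder {suc k} (k !) x) ≡⟨ cong₂ combine q≡q′ r≡r′ ⟩
  combine (quotient (k !) y) (remainder {suc k} (k !) y) ≡⟨ combine-remQuot {suc k} (k !) y ⟩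
  y                                                      ∎
  where
  open ≡-Reasoning
  q≡q′ : quotient (k !) x ≡ quotient (k !) y
  q≡q′ = eq zero
  r≡r′ : remainder {suc k} (k !) x ≡ remainder {suc k} (k !) y
  r≡r′ = lehmer-faithful k λ j →
    punchIn-injective _ _ _ (trans (eq (suc j)) (cong (λ c → punchIn c _) (sym q≡q′)))

StrictlyIncreasing : ∀ {k} → (Fin k → ℕ) → Set
StrictlyIncreasing g = ∀ j j′ → j <ᶠ j′ → g j < g j′

head≤lo : ∀ k lo (g : Fin (suc k) → ℕ) → StrictlyIncreasing g →
  (∀ j → g j < lo + suc k) → (∀ j → g (suc j) ≡ suc lo + toℕ j) → g zero ≤ lo
head≤lo zero    lo g _   ub _    = <⇒≤pred (subst (g zero <_) (+-comm lo 1) (ub zero))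
head≤lo (suc k) lo g inc _  tail = <⇒≤pred (subst (g zero <_) g₁≡1+lo (inc zero (suc zero) (s≤s z≤n)))
  where
  g₁≡1+lo : g (suc zero) ≡ suc lo
  g₁≡1+lo = trans (tail zero) (cong suc (+-identityʳ lo))

increasing-in-interval : ∀ k lo (g : Fin k → ℕ) → StrictlyIncreasing g →
  (∀ j → lo ≤ g j) → (∀ j → g j < lo + k) → ∀ j → g j ≡ lo + toℕ j
increasing-in-interval zero    lo g _   _  _  ()
increasing-in-interval (suc k) lo g inc lb ub = values
  where
  tail : ∀ j → g (suc j) ≡ suc lo + toℕ j
  tail = increasing-in-interval k (suc lo) (g ∘ suc)
           (λ j j′ j<j′ → inc (suc j) (suc j′) (s≤s j<j′))
           (λ j → ≤-<-trans (lb zero) (inc zero (suc j) (s≤s z≤n)))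
           (λ j → subst (g (suc j) <_) (+-suc lo k) (ub (suc j)))
  values : ∀ j → g j ≡ lo + toℕ j
  values zero    = trans (≤-antisym (head≤lo k lo g inc ub tail) (lb zero)) (sym (+-identityʳ lo))
  values (suc j) = trans (tail j) (sym (+-suc lo (toℕ j)))

sorted-values : ∀ {k} {r : Fin k → ℕ} {σ : Fin k → Fin k} → IsPermOf1k k r →
  StrictlyIncreasing (r ∘ σ) → ∀ j → r (σ j) ≡ suc (toℕ j)
sorted-values {σ = σ} (bounds , _) inc =
  increasing-in-interval _ 1 _ inc (proj₁ ∘ bounds ∘ σ) (s≤s ∘ proj₂ ∘ bounds ∘ σ)

sorting-determines-perm : ∀ {k} {r r′ : Fin k → ℕ} {σ : Fin k → Fin k} →
  IsPermOf1k k r → IsPermOf1k k r′ → StrictlyIncreasing (r ∘ σ) → StrictlyIncreasing (r′ ∘ σ) →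
  ∀ p → r p ≡ r′ p
sorting-determines-perm {r = r} {r′} {σ} r-perm@(bounds , r-inj) r′-perm inc inc′ p
  with r p in rp≡ | bounds p
... | suc w | _ , w<k = begin
  suc w          ≡⟨ cong suc (toℕ-fromℕ< w<k) ⟨
  suc (toℕ j)    ≡⟨ sorted-values r′-perm inc′ j ⟨
  r′ (σ j)       ≡⟨ cong r′ σj≡p ⟩
  r′ p           ∎
  where
  open ≡-Reasoning
  j : Fin _
  j = fromℕ< w<k
  σj≡p : σ j ≡ p
  σj≡p = r-inj (trans (sorted-values r-perm inc j) (trans (cong suc (toℕ-fromℕ< w<k)) (sym rp≡)))

module _ {n k : ℕ} where

  sortedOutput-determines-input : ∀ {a b : Input n k} {S : Output n k} →
    Valid n k a → Valid n k b → SortedOutput n k a S → SortedOutput n k b S →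
    ∀ i j → a i j ≡ b i j
  sortedOutput-determines-input va vb sa sb i =
    sorting-determines-perm (va i) (vb i) (sa i) (sb i)

  permInput : (Fin n → Fin k → Fin k) → Input n k
  permInput σ i j = suc (toℕ (σ i j))

  permInput-valid : ∀ (σ : Fin n → Fin k → Fin k) →
    (∀ i → Injective _≡_ _≡_ (σ i)) → Valid n k (permInput σ)
  permInput-valid σ σ-inj i =
    (λ j → s≤s z≤n , toℕ<n (σ i j)) , σ-inj i ∘ toℕ-injective ∘ suc-injective

  lehmerInput : Fin ((k !) ^ n) → Input n k
  lehmerInput x = permInput (λ i → lehmer k (finToFun {k !} x i))

  lehmerInput-valid : ∀ x → Valid n k (lehmerInput x)
  lehmerInput-valid x = permInput-valid _ λ i → lehmer-injective k (finToFun {k !} x i)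

  lehmerInput-faithful : ∀ {x y} → (∀ i j → lehmerInput x i j ≡ lehmerInput y i j) → x ≡ y
  lehmerInput-faithful eq =
    finToFun-faithful λ i → lehmer-faithful k λ j → toℕ-injective (suc-injective (eq i j))

  solver-distinguishes-lehmerInputs : ∀ T → Solves n k T →
    ∀ x y → run T (lehmerInput x) ≡ run T (lehmerInput y) → x ≡ y
  solver-distinguishes-lehmerInputs T solves x y same-run =
    lehmerInput-faithful (sortedOutput-determines-input (lehmerInput-valid x) (lehmerInput-valid y)
      (solves _ (lehmerInput-valid x))
      (subst (SortedOutput n k (lehmerInput y)) (sym same-run) (solves _ (lehmerInput-valid y))))

cmpToFin : Cmp → Fin 3
cmpToFin less    = zero
cmpToFin equal   = suc zero
cmpToFin greater = suc (suc zero)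

cmpToFin-injective : Injective _≡_ _≡_ cmpToFin
cmpToFin-injective {less}    {less}    _ = refl
cmpToFin-injective {equal}   {equal}   _ = refl
cmpToFin-injective {greater} {greater} _ = refl

module _ {n k : ℕ} where

  outcome : LinForm n k → LinForm n k → Input n k → Cmp
  outcome x y a = compareℕ (eval x a) (eval y a)

  -- The outcomes of the comparisons made on a, as a base-3 numeral of D digits;
  -- a leaf reached early is padded by a fixed value.
  transcript : ∀ D (T : Tree n k) a → comparisons T a ≤ D → Fin (3 ^ D)
  transcript D       (leaf _)     a _       = fromℕ< (m^n>0 3 D)
  transcript (suc D) (node x y t) a (s≤s p) =
    combine (cmpToFin (outcome x y a)) (transcript D (t (outcome x y a)) a p)

  transcript-determines-run : ∀ D (T : Tree n k) a b p q →
    transcript D T a p ≡ transcript D T b q → run T a ≡ run T b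
  transcript-determines-run D       (leaf _)     a b _ _ _ = refl
  transcript-determines-run (suc D) (node x y t) a b (s≤s p) (s≤s q) eq
    with outcome x y a | outcome x y b
  ... | c | d with combine-injective (cmpToFin c) _ (cmpToFin d) _ eq
  ... | c≡d , rest with cmpToFin-injective {c} {d} c≡d
  ... | refl = transcript-determines-run D (t c) a b p q rest

  distinguished≤3^depth : ∀ {N} D (T : Tree n k) (f : Fin N → Input n k) →
    (∀ x → comparisons T (f x) ≤ D) → (∀ x y → run T (f x) ≡ run T (f y) → x ≡ y) →
    N ≤ 3 ^ D
  distinguished≤3^depth D T f depth distinct = injective⇒≤ {f = λ x → transcript D T (f x) (depth x)}
    λ {x} {y} eq → distinct x y (transcript-determines-run D T (f x) (f y) _ _ eq)

mainTheorem18 : ∃[ c ] ∀ (n k : ℕ) (T : Tree n k) → Solves n k T →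
                  ∃[ a ] (Valid n k a × n * k * ⌊log₂ k ⌋ ≤ c * comparisons T a)
mainTheorem18 = 4 , λ n k T solves →
  let x₀ : Fin ((k !) ^ n)
      x₀ = fromℕ< (m^n>0 (k !) {{k !≢0}} n)
      (x , worst) = maximum-attained x₀ (comparisons T ∘ lehmerInput)
  in lehmerInput x , lehmerInput-valid x ,
     [n!]^m≤3^d⇒m*n*⌊log₂n⌋≤4*d n k (comparisons T (lehmerInput x))
       (distinguished≤3^depth _ T lehmerInput worst (solver-distinguishes-lehmerInputs T solves))
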